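{- For every integer $n\ge 3$, the wheel $W_n$ has Frank number $2$.
   Context: The wheel $W_n$ consists of a cycle $v_1v_2\cdots v_n$ together with a hub vertex $v_0$ adjacent to every $v_i$. An orientation of a graph replaces each edge $uv$ by exactly one of the arcs $(u,v)$, $(v,u)$. An oriented graph is strongly connected if for any two vertices $x,y$ there is a directed $(x,y)$-path. In an orientation $O$ of $G$, an edge $e$ is deletable if $O-e$ is strongly connected. For a $3$-edge-connected graph $G$, the Frank number $F(G)$ is the minimum $k$ such that $G$ admits $k$ orientations with the property that every edge of $G$ is deletable in at least one of them. -}

module Defs where

open import Data.Nat using (ℕ; zero; suc; _<_; s≤s)
open import Data.Nat.Properties using (_<?_)
open import Data.Fin using (Fin; zero; suc; toℕ; fromℕ<)
open import Data.Bool using (Bool; true; false)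
open import Data.Sum using (_⊎_; inj₁; inj₂)
open import Data.Product using (Σ; _×_; _,_; ∃)
open import Relation.Nullary using (¬_; yes; no)
open import Relation.Binary.PropositionalEquality using (_≡_; _≢_)
open import Relation.Binary.Construct.Closure.ReflexiveTransitive using (Star)

record Graph : Set₁ where
  field
    V     : ℕ
    Edge  : Set
    ends  : Edge → Fin V × Fin V
open Graph public

-- An orientation chooses, for each edge uv (ends = (u , v)),
-- either the arc (u,v) (false) or the arc (v,u) (true).
Orientation : Graph → Set
Orientation G = Edge G → Bool

arcOf : (G : Graph) → Orientation G → Edge G → Fin (V G) × Fin (V G)
arcOf G O e with ends G e | O e
... | (u , v) | false = (u , v)
... | (u , v) | true  = (v , u)

ArcWithout : (G : Graph) → Orientation G → Edge G → Fin (V G) → Fin (V G) → Set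
ArcWithout G O e x y = Σ (Edge G) λ f → f ≢ e × arcOf G O f ≡ (x , y)

Arc : (G : Graph) → Orientation G → Fin (V G) → Fin (V G) → Set
Arc G O x y = Σ (Edge G) λ f → arcOf G O f ≡ (x , y)

StronglyConnectedRel : ∀ {n} → (Fin n → Fin n → Set) → Set
StronglyConnectedRel R = ∀ x y → Star R x y

Deletable : (G : Graph) → Orientation G → Edge G → Set
Deletable G O e = StronglyConnectedRel (ArcWithout G O e)

FrankFamily : Graph → ℕ → Set
FrankFamily G k =
  Σ (Fin k → Orientation G) λ Os → ∀ (e : Edge G) → ∃ λ (i : Fin k) → Deletable G (Os i) e

FrankNumber : Graph → ℕ → Set
FrankNumber G k = FrankFamily G k × (∀ m → m < k → ¬ FrankFamily G m)

cycSucc : ∀ {n} → Fin n → Fin n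
cycSucc {suc m} i with toℕ i <? m
... | yes p = fromℕ< (s≤s p)
... | no _  = zero

-- The wheel W_n: vertex 0 is the hub v₀, vertex suc i is the rim vertex v_{i+1}.
-- Edges: spokes (inj₁ i) = v₀ v_{i+1}, rim edges (inj₂ i) = v_{i+1} v_{i+2 mod n}.
wheelEnds : (n : ℕ) → Fin n ⊎ Fin n → Fin (suc n) × Fin (suc n)
wheelEnds n (inj₁ i) = (zero , suc i)
wheelEnds n (inj₂ i) = (suc i , suc (cycSucc i))

Wheel : ℕ → Graph
Wheel n = record { V = suc n ; Edge = Fin n ⊎ Fin n ; ends = wheelEnds n }

-- A vertex of degree three has, in any orientation, a sole out-arc or a sole
-- in-arc, and deleting that edge cuts the vertex off.  Rim vertices of a wheel
-- have degree three, so no single orientation makes every edge deletable.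
-- Two orientations suffice.  O₂ makes the rim a directed cycle and lets the spokes
-- alternately leave and enter the hub; then every odd rim edge and every spoke but
-- spoke 1 is deletable.  O₁ directs the rim path rim 0 → … → rim last forwards and
-- the closing rim edge from rim 0 to rim last, and lets spoke 0 leave the hub,
-- the last spoke enter it, and the other spokes enter it when even and leave it
-- when odd.  Then hub → rim 0 → … → rim last → hub is a directed Hamiltonian
-- cycle, so every edge off it is deletable, and so is every even rim edge.  The
-- odd last spoke is left to O₂, which is possible because n ≥ 3.

module Submission where

open import Defs
open import Data.Bool using (Bool; true; false; not; _∨_)
open import Data.Bool.Properties using (∨-zeroʳ; not-¬)
open import Data.Empty using (⊥-elim)
open import Data.Fin as Fin using (Fin; zero; suc; toℕ; fromℕ; inject₁; _≟_)
open import Data.Fin.Properties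
  using (toℕ-injective; toℕ-fromℕ; toℕ-inject₁; toℕ-fromℕ<; toℕ<n; ≤fromℕ; _≤?_; <⇒≢; fromℕ≢inject₁; suc-injective)
open import Data.Fin.Induction using (<-weakInduction)
open import Data.Nat as ℕ using (ℕ; _≤_; _<_; z≤n; s≤s)
import Data.Nat.Properties as ℕ
open import Data.Product using (∃; ∃₂; _×_; _,_; proj₁; proj₂; swap)
open import Data.Sum using (_⊎_; inj₁; inj₂)
open import Data.Sum.Properties using (inj₁-injective; inj₂-injective)
open import Function using (_∘_)
open import Relation.Binary.Definitions using (DecidableEquality)
open import Relation.Binary.PropositionalEquality
open import Relation.Binary.Construct.Closure.ReflexiveTransitive using (Star; ε; _◅_; _◅◅_)
open import Relation.Nullary using (¬_; yes; no; does; contradiction)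
open import Relation.Nullary.Decidable using (dec-true; dec-false)

Incident : (G : Graph) → Fin (V G) → Edge G → Set
Incident G x f = proj₁ (ends G f) ≡ x ⊎ proj₂ (ends G f) ≡ x

module _ (G : Graph) (O : Orientation G) where

  arcOf-false : ∀ f → O f ≡ false → arcOf G O f ≡ ends G f
  arcOf-false f _ with ends G f | O f
  ... | _ , _ | false = refl

  arcOf-true : ∀ f → O f ≡ true → arcOf G O f ≡ swap (ends G f)
  arcOf-true f _ with ends G f | O f
  ... | _ , _ | true = refl

  arc-forward : ∀ {e} f → O f ≡ false → f ≢ e → ArcWithout G O e (proj₁ (ends G f)) (proj₂ (ends G f))
  arc-forward f Of≡false f≢e = f , f≢e , arcOf-false f Of≡false

  arc-backward : ∀ {e} f → O f ≡ true → f ≢ e → ArcWithout G O e (proj₂ (ends G f)) (proj₁ (ends G f))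
  arc-backward f Of≡true f≢e = f , f≢e , arcOf-true f Of≡true

  arcOf-ends : ∀ f → arcOf G O f ≡ ends G f ⊎ arcOf G O f ≡ swap (ends G f)
  arcOf-ends f with ends G f | O f
  ... | _ , _ | false = inj₁ refl
  ... | _ , _ | true  = inj₂ refl

  arc-tail-incident : ∀ f {x z} → arcOf G O f ≡ (x , z) → Incident G x f
  arc-tail-incident f arc with arcOf-ends f
  ... | inj₁ same    = inj₁ (cong proj₁ (trans (sym same) arc))
  ... | inj₂ swapped = inj₂ (cong proj₁ (trans (sym swapped) arc))

  arc-head-incident : ∀ f {x z} → arcOf G O f ≡ (z , x) → Incident G x f
  arc-head-incident f arc with arcOf-ends f
  ... | inj₁ same    = inj₂ (cong proj₂ (trans (sym same) arc))
  ... | inj₂ swapped = inj₁ (cong proj₂ (trans (sym swapped) arc))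

module _ {a ℓ} {A : Set a} {R : A → A → Set ℓ} (_≟ᴬ_ : DecidableEquality A) where

  first-exit : ∀ {x y} → x ≢ y → Star R x y → ∃ λ z → z ≢ x × R x z
  first-exit x≢y ε = contradiction refl x≢y
  first-exit {x} x≢y (_◅_ {j = z} r rest) with z ≟ᴬ x
  ... | no z≢x  = z , z≢x , r
  ... | yes refl = first-exit x≢y rest

  last-entry : ∀ {x y} → y ≢ x → Star R y x → ∃ λ z → z ≢ x × R z x
  last-entry y≢x ε = contradiction refl y≢x
  last-entry {x} {y} y≢x (_◅_ {j = w} r rest) with w ≟ᴬ x
  ... | yes refl = y , y≢x , r
  ... | no w≢x  = last-entry w≢x rest

SoleExit : (G : Graph) → Orientation G → Fin (V G) → Edge G → Set
SoleExit G O x e = ∀ f {z} → z ≢ x → arcOf G O f ≡ (x , z) → f ≡ e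

SoleEntry : (G : Graph) → Orientation G → Fin (V G) → Edge G → Set
SoleEntry G O x e = ∀ f {z} → z ≢ x → arcOf G O f ≡ (z , x) → f ≡ e

module _ {G : Graph} {O : Orientation G} {x y : Fin (V G)} {e : Edge G} where

  sole-exit⇒¬deletable : x ≢ y → SoleExit G O x e → ¬ Deletable G O e
  sole-exit⇒¬deletable x≢y sole deletable with first-exit _≟_ x≢y (deletable x y)
  ... | _ , z≢x , f , f≢e , arc = f≢e (sole f z≢x arc)

  sole-entry⇒¬deletable : y ≢ x → SoleEntry G O x e → ¬ Deletable G O e
  sole-entry⇒¬deletable y≢x sole deletable with last-entry _≟_ y≢x (deletable y x)
  ... | _ , z≢x , f , f≢e , arc = f≢e (sole f z≢x arc)

some-value-at-most-once : (b : Fin 3 → Bool) → ∃₂ λ v k → ∀ i → b i ≡ v → i ≡ k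
some-value-at-most-once b with b zero in b₀ | b (suc zero) in b₁ | b (suc (suc zero)) in b₂
... | true  | true  | _     = false , suc (suc zero) , λ { zero p → ⊥-elim (not-¬ b₀ p) ; (suc zero) p → ⊥-elim (not-¬ b₁ p) ; (suc (suc zero)) _ → refl }
... | false | false | _     = true  , suc (suc zero) , λ { zero p → ⊥-elim (not-¬ b₀ p) ; (suc zero) p → ⊥-elim (not-¬ b₁ p) ; (suc (suc zero)) _ → refl }
... | true  | false | true  = false , suc zero       , λ { zero p → ⊥-elim (not-¬ b₀ p) ; (suc zero) _ → refl ; (suc (suc zero)) p → ⊥-elim (not-¬ b₂ p) }
... | false | true  | false = true  , suc zero       , λ { zero p → ⊥-elim (not-¬ b₀ p) ; (suc zero) _ → refl ; (suc (suc zero)) p → ⊥-elim (not-¬ b₂ p) }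
... | true  | false | false = true  , zero           , λ { zero _ → refl ; (suc zero) p → ⊥-elim (not-¬ b₁ p) ; (suc (suc zero)) p → ⊥-elim (not-¬ b₂ p) }
... | false | true  | true  = false , zero           , λ { zero _ → refl ; (suc zero) p → ⊥-elim (not-¬ b₁ p) ; (suc (suc zero)) p → ⊥-elim (not-¬ b₂ p) }

module _ (G : Graph) {x : Fin (V G)} (es : Fin 3 → Edge G)
         (incident⇒ : ∀ f → Incident G x f → ∃ λ i → f ≡ es i) where

  sole-exit-or-entry : ∀ O → ∃ λ e → SoleExit G O x e ⊎ SoleEntry G O x e
  sole-exit-or-entry O with some-value-at-most-once (λ i → does (proj₁ (arcOf G O (es i)) ≟ x))
  ... | true , k , once = es k , inj₁ sole
    where
    sole : SoleExit G O x (es k)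
    sole f _ arc with incident⇒ f (arc-tail-incident G O f arc)
    ... | i , refl = cong es (once i (dec-true (_ ≟ x) (cong proj₁ arc)))
  ... | false , k , once = es k , inj₂ sole
    where
    sole : SoleEntry G O x (es k)
    sole f z≢x arc with incident⇒ f (arc-head-incident G O f arc)
    ... | i , refl = cong es (once i (dec-false (_ ≟ x) (z≢x ∘ trans (sym (cong proj₁ arc)))))

  ¬all-deletable : ∀ {y} → x ≢ y → ∀ O → ¬ (∀ e → Deletable G O e)
  ¬all-deletable x≢y O all-deletable with sole-exit-or-entry O
  ... | e , inj₁ exit  = sole-exit⇒¬deletable x≢y exit (all-deletable e)
  ... | e , inj₂ entry = sole-entry⇒¬deletable (x≢y ∘ sym) entry (all-deletable e)

  ¬frankFamily<2 : ∀ {y} → x ≢ y → ∀ k → k < 2 → ¬ FrankFamily G k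
  ¬frankFamily<2 _ 0 _ (_ , cover) with () ← proj₁ (cover (es zero))
  ¬frankFamily<2 x≢y 1 _ (Os , cover) = ¬all-deletable x≢y (Os zero) (deletable-in-Os₀ ∘ cover)
    where
    deletable-in-Os₀ : ∀ {e} → ∃ (λ i → Deletable G (Os i) e) → Deletable G (Os zero) e
    deletable-in-Os₀ (zero , deletable) = deletable
  ¬frankFamily<2 _ (ℕ.suc (ℕ.suc _)) (s≤s (s≤s ()))

pattern spoke k   = inj₁ k
pattern rimEdge t = inj₂ t

hub : ∀ {n} → Fin (ℕ.suc n)
hub = zero

rim : ∀ {n} → Fin n → Fin (ℕ.suc n)
rim = suc

cycSucc-inject₁ : ∀ {n} (j : Fin n) → cycSucc (inject₁ j) ≡ suc j
cycSucc-inject₁ {n} j with toℕ (inject₁ j) ℕ.<? n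
... | yes j<n = toℕ-injective (trans (toℕ-fromℕ< (s≤s j<n)) (cong ℕ.suc (toℕ-inject₁ j)))
... | no j≮n  = contradiction (subst (ℕ._< n) (sym (toℕ-inject₁ j)) (toℕ<n j)) j≮n

cycSucc-fromℕ : ∀ n → cycSucc (fromℕ n) ≡ zero
cycSucc-fromℕ n with toℕ (fromℕ n) ℕ.<? n
... | yes n<n = contradiction (subst (ℕ._< n) (toℕ-fromℕ n) n<n) (ℕ.<-irrefl refl)
... | no _    = refl

cycSucc≡zero⇒≡fromℕ : ∀ {n} (i : Fin (ℕ.suc n)) → cycSucc i ≡ zero → i ≡ fromℕ n
cycSucc≡zero⇒≡fromℕ {n} i _ with toℕ i ℕ.<? n
cycSucc≡zero⇒≡fromℕ {n} i () | yes _
... | no i≮n = toℕ-injective (trans (ℕ.≤-antisym (ℕ.≤-pred (toℕ<n i)) (ℕ.≮⇒≥ i≮n)) (sym (toℕ-fromℕ n)))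

last-or-inject₁ : ∀ {n} (k : Fin (ℕ.suc n)) → k ≡ fromℕ n ⊎ ∃ λ j → k ≡ inject₁ j
last-or-inject₁ {ℕ.zero}  zero    = inj₁ refl
last-or-inject₁ {ℕ.suc _} zero    = inj₂ (zero , refl)
last-or-inject₁ {ℕ.suc _} (suc k) with last-or-inject₁ k
... | inj₁ refl       = inj₁ refl
... | inj₂ (j , refl) = inj₂ (suc j , refl)

rim₀-edges : ∀ {n} → Fin 3 → Edge (Wheel (ℕ.suc n))
rim₀-edges         zero             = spoke zero
rim₀-edges         (suc zero)       = rimEdge zero
rim₀-edges {n}     (suc (suc zero)) = rimEdge (fromℕ n)

incident-rim₀ : ∀ {n} f → Incident (Wheel (ℕ.suc n)) (rim zero) f → ∃ λ i → f ≡ rim₀-edges i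
incident-rim₀ (spoke _)   (inj₁ ())
incident-rim₀ (spoke _)   (inj₂ refl) = zero , refl
incident-rim₀ (rimEdge _) (inj₁ refl) = suc zero , refl
incident-rim₀ (rimEdge t) (inj₂ next≡rim₀) = suc (suc zero) , cong rimEdge (cycSucc≡zero⇒≡fromℕ t (suc-injective next≡rim₀))

wheel-¬frankFamily<2 : ∀ n k → k < 2 → ¬ FrankFamily (Wheel (ℕ.suc n)) k
wheel-¬frankFamily<2 n = ¬frankFamily<2 (Wheel (ℕ.suc n)) rim₀-edges incident-rim₀ {y = hub} (λ ())

Walk : ∀ {n} → Orientation (Wheel n) → Edge (Wheel n) → Fin (ℕ.suc n) → Fin (ℕ.suc n) → Set
Walk {n} O e = Star (ArcWithout (Wheel n) O e)

Forward : ∀ {n} → Orientation (Wheel n) → Edge (Wheel n) → Fin n → Set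
Forward O e t = O (rimEdge t) ≡ false × rimEdge t ≢ e

module _ {n} {O : Orientation (Wheel n)} {e : Edge (Wheel n)} where

  spoke-out : ∀ {k} → O (spoke k) ≡ false → spoke k ≢ e → Walk O e hub (rim k)
  spoke-out {k} out k≢e = arc-forward (Wheel n) O (spoke k) out k≢e ◅ ε

  spoke-in : ∀ {k} → O (spoke k) ≡ true → spoke k ≢ e → Walk O e (rim k) hub
  spoke-in {k} in′ k≢e = arc-backward (Wheel n) O (spoke k) in′ k≢e ◅ ε

  rim-forward : ∀ {t} → Forward O e t → Walk O e (rim t) (rim (cycSucc t))
  rim-forward {t} (fwd , t≢e) = arc-forward (Wheel n) O (rimEdge t) fwd t≢e ◅ ε

  rim-backward : ∀ {t} → O (rimEdge t) ≡ true → rimEdge t ≢ e → Walk O e (rim (cycSucc t)) (rim t)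
  rim-backward {t} bwd t≢e = arc-backward (Wheel n) O (rimEdge t) bwd t≢e ◅ ε

  deletable-via-hub : (∀ k → Walk O e hub (rim k)) → (∀ k → Walk O e (rim k) hub) → Deletable (Wheel n) O e
  deletable-via-hub from-hub to-hub zero    zero    = ε
  deletable-via-hub from-hub to-hub zero    (suc y) = from-hub y
  deletable-via-hub from-hub to-hub (suc x) zero    = to-hub x
  deletable-via-hub from-hub to-hub (suc x) (suc y) = to-hub x ◅◅ from-hub y

module _ {n} {O : Orientation (Wheel (ℕ.suc n))} {e : Edge (Wheel (ℕ.suc n))} where

  rim-walk : ∀ {i j : Fin (ℕ.suc n)} → i Fin.≤ j → (∀ t → i Fin.≤ t → t Fin.< j → Forward O e t) → Walk O e (rim i) (rim j)
  rim-walk {i} {j} = <-weakInduction P walk-to-zero walk-one-further j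
    where
    P : Fin (ℕ.suc n) → Set
    P j = i Fin.≤ j → (∀ t → i Fin.≤ t → t Fin.< j → Forward O e t) → Walk O e (rim i) (rim j)

    walk-to-zero : P zero
    walk-to-zero i≤0 _ = subst (Walk O e (rim i) ∘ rim) (toℕ-injective (ℕ.n≤0⇒n≡0 i≤0)) ε

    walk-one-further : ∀ j → P (inject₁ j) → P (suc j)
    walk-one-further j walk-to-j i≤1+j fwd with i ≤? inject₁ j
    ... | yes i≤j = walk-to-j i≤j (λ t i≤t t<j → fwd t i≤t (ℕ.≤-trans t<j (ℕ.m≤n⇒m≤1+n j≤j)))
                    ◅◅ subst (Walk O e (rim (inject₁ j)) ∘ rim) (cycSucc-inject₁ j)
                         (rim-forward (fwd (inject₁ j) i≤j (s≤s j≤j)))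
      where
      j≤j : toℕ (inject₁ j) ≤ toℕ j
      j≤j = ℕ.≤-reflexive (toℕ-inject₁ j)
    ... | no i≰j = subst (Walk O e (rim i) ∘ rim) i≡1+j ε
      where
      i≡1+j : i ≡ suc j
      i≡1+j = toℕ-injective (ℕ.≤-antisym i≤1+j (subst (ℕ._< toℕ i) (toℕ-inject₁ j) (ℕ.≰⇒> i≰j)))

  rim-cycle-walk : (∀ t → Forward O e t) → ∀ i j → Walk O e (rim i) (rim j)
  rim-cycle-walk fwd i j =
    rim-walk (≤fromℕ i) (λ t _ _ → fwd t)
    ◅◅ subst (Walk O e (rim (fromℕ n)) ∘ rim) (cycSucc-fromℕ n) (rim-forward (fwd (fromℕ n)))
    ◅◅ rim-walk z≤n (λ t _ _ → fwd t)

isEven : ℕ → Bool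
isEven ℕ.zero    = true
isEven (ℕ.suc k) = not (isEven k)

isEven-inject₁ : ∀ {n} (j : Fin n) → isEven (toℕ (inject₁ j)) ≡ isEven (toℕ j)
isEven-inject₁ j = cong isEven (toℕ-inject₁ j)

parity-separates : ∀ {n} {a b : Fin n} → isEven (toℕ a) ≡ true → isEven (toℕ b) ≡ false → a ≢ b
parity-separates a-even b-odd refl = contradiction (trans (sym a-even) b-odd) λ ()

module FrankPair (m : ℕ) where

  L : ℕ
  L = ℕ.suc (ℕ.suc m)

  W : Graph
  W = Wheel (ℕ.suc L)

  last : Fin (ℕ.suc L)
  last = fromℕ L

  O₂ : Orientation W
  O₂ (spoke k)   = not (isEven (toℕ k))
  O₂ (rimEdge _) = false

  O₂-rim-deletable : ∀ i → isEven (toℕ i) ≡ false → Deletable W O₂ (rimEdge i)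
  O₂-rim-deletable i i-odd = deletable-via-hub from-hub to-hub
    where
    even-forward : ∀ {t} → isEven (toℕ t) ≡ true → Forward O₂ (rimEdge i) t
    even-forward t-even = refl , parity-separates t-even i-odd ∘ inj₂-injective

    from-hub : ∀ k → Walk O₂ (rimEdge i) hub (rim k)
    from-hub zero = spoke-out refl (λ ())
    from-hub (suc k) with isEven (toℕ k) in k-parity
    ... | false = spoke-out (cong (not ∘ not) k-parity) (λ ())
    ... | true  = spoke-out (cong not k-even) (λ ())
                  ◅◅ subst (Walk O₂ (rimEdge i) (rim (inject₁ k)) ∘ rim) (cycSucc-inject₁ k)
                       (rim-forward (even-forward k-even))
      where
      k-even : isEven (toℕ (inject₁ k)) ≡ true
      k-even = trans (isEven-inject₁ k) k-parity

    to-hub : ∀ k → Walk O₂ (rimEdge i) (rim k) hub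
    to-hub k with isEven (toℕ k) in k-parity | last-or-inject₁ k
    ... | false | _ = spoke-in (cong not k-parity) (λ ())
    ... | true | inj₁ refl =
      rim-forward (even-forward k-parity)
      ◅◅ subst (λ v → Walk O₂ (rimEdge i) (rim v) hub) (sym (cycSucc-fromℕ L))
           (rim-forward (even-forward {zero} refl) ◅◅ spoke-in refl (λ ()))
    ... | true | inj₂ (j , refl) =
      rim-forward (even-forward k-parity)
      ◅◅ subst (λ v → Walk O₂ (rimEdge i) (rim v) hub) (sym (cycSucc-inject₁ j))
           (spoke-in (cong (not ∘ not) (trans (sym (isEven-inject₁ j)) k-parity)) (λ ()))

  O₂-spoke-deletable : ∀ j → j ≢ suc zero → Deletable W O₂ (spoke j)
  O₂-spoke-deletable j j≢1 = deletable-via-hub from-hub to-hub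
    where
    around : ∀ a b → Walk O₂ (spoke j) (rim a) (rim b)
    around = rim-cycle-walk (λ _ → refl , λ ())

    exit-spoke : ∀ j → ∃ λ a → Walk O₂ (spoke j) hub (rim a)
    exit-spoke zero    = suc (suc zero) , spoke-out refl (λ ())
    exit-spoke (suc _) = zero , spoke-out refl (λ ())

    from-hub : ∀ k → Walk O₂ (spoke j) hub (rim k)
    from-hub k = proj₂ (exit-spoke j) ◅◅ around _ k

    to-hub : ∀ k → Walk O₂ (spoke j) (rim k) hub
    to-hub k = around k (suc zero) ◅◅ spoke-in refl (j≢1 ∘ sym ∘ inj₁-injective)

  isLast : Fin (ℕ.suc L) → Bool
  isLast t = does (t ≟ last)

  O₁ : Orientation W
  O₁ (spoke zero)    = false
  O₁ (spoke (suc k)) = isEven (toℕ (suc k)) ∨ isLast (suc k)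
  O₁ (rimEdge t)     = isLast t

  module _ {e : Edge W} where

    O₁-rim-walk : ∀ {i j} → i Fin.≤ j → (∀ t → i Fin.≤ t → t Fin.< j → rimEdge t ≢ e) → Walk O₁ e (rim i) (rim j)
    O₁-rim-walk {j = j} i≤j avoid = rim-walk i≤j λ t i≤t t<j →
      dec-false (t ≟ last) (<⇒≢ (ℕ.<-≤-trans t<j (≤fromℕ j))) , avoid t i≤t t<j

    O₁-hub→rim₀ : spoke zero ≢ e → Walk O₁ e hub (rim zero)
    O₁-hub→rim₀ = spoke-out refl

    O₁-rim₀→last : rimEdge last ≢ e → Walk O₁ e (rim zero) (rim last)
    O₁-rim₀→last last≢e = subst (λ v → Walk O₁ e (rim v) (rim last)) (cycSucc-fromℕ L)
                                (rim-backward (dec-true (last ≟ last) refl) last≢e)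

    O₁-last→hub : spoke last ≢ e → Walk O₁ e (rim last) hub
    O₁-last→hub = spoke-in (trans (cong (isEven (toℕ last) ∨_) (dec-true (last ≟ last) refl)) (∨-zeroʳ _))

  O₁-deletable-off-cycle : ∀ {e} → spoke zero ≢ e → spoke last ≢ e → (∀ t → t Fin.< last → rimEdge t ≢ e) → Deletable W O₁ e
  O₁-deletable-off-cycle s₀≢e sₗ≢e avoid = deletable-via-hub
    (λ k → O₁-hub→rim₀ s₀≢e ◅◅ O₁-rim-walk z≤n (λ t _ t<k → avoid t (ℕ.<-≤-trans t<k (≤fromℕ k))))
    (λ k → O₁-rim-walk (≤fromℕ k) (λ t _ → avoid t) ◅◅ O₁-last→hub sₗ≢e)

  O₁-rim-deletable : ∀ (i : Fin L) → isEven (toℕ i) ≡ true → Deletable W O₁ (rimEdge (inject₁ i))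
  O₁-rim-deletable i i-even = deletable-via-hub from-hub to-hub
    where
    e : Edge W
    e = rimEdge (inject₁ i)

    avoid : ∀ {t} → t ≢ inject₁ i → rimEdge t ≢ e
    avoid t≢i = t≢i ∘ inj₂-injective

    i<⇒1+i≤ : ∀ {t} → inject₁ i Fin.< t → suc i Fin.≤ t
    i<⇒1+i≤ {t} = subst (λ x → ℕ.suc x ≤ toℕ t) (toℕ-inject₁ i)

    1+i≤⇒i< : ∀ {t} → suc i Fin.≤ t → inject₁ i Fin.< t
    1+i≤⇒i< {t} = subst (λ x → ℕ.suc x ≤ toℕ t) (sym (toℕ-inject₁ i))

    hub→rim₁₊ᵢ : Walk O₁ e hub (rim (suc i))
    hub→rim₁₊ᵢ with suc i ≟ last
    ... | yes 1+i≡last = subst (Walk O₁ e hub ∘ rim) (sym 1+i≡last)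
                           (O₁-hub→rim₀ (λ ()) ◅◅ O₁-rim₀→last (fromℕ≢inject₁ ∘ inj₂-injective))
    ... | no 1+i≢last  = spoke-out (cong₂ _∨_ (cong not i-even) (dec-false (suc i ≟ last) 1+i≢last)) (λ ())

    rimⱼ→hub : ∀ j → isEven (toℕ j) ≡ true → Walk O₁ e (rim (inject₁ j)) hub
    rimⱼ→hub zero    _      = O₁-rim₀→last (fromℕ≢inject₁ ∘ inj₂-injective) ◅◅ O₁-last→hub (λ ())
    rimⱼ→hub (suc j) j-even = spoke-in (cong (_∨ isLast (inject₁ (suc j))) (trans (cong (isEven ∘ ℕ.suc) (toℕ-inject₁ j)) j-even)) (λ ())

    from-hub : ∀ k → Walk O₁ e hub (rim k)
    from-hub k with k ≤? inject₁ i
    ... | yes k≤i = O₁-hub→rim₀ (λ ()) ◅◅ O₁-rim-walk z≤n (λ t _ t<k → avoid (<⇒≢ (ℕ.<-≤-trans t<k k≤i)))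
    ... | no k≰i  = hub→rim₁₊ᵢ ◅◅ O₁-rim-walk (i<⇒1+i≤ (ℕ.≰⇒> k≰i)) (λ t 1+i≤t _ → avoid (<⇒≢ (1+i≤⇒i< 1+i≤t) ∘ sym))

    to-hub : ∀ k → Walk O₁ e (rim k) hub
    to-hub k with k ≤? inject₁ i
    ... | yes k≤i = O₁-rim-walk k≤i (λ t _ t<i → avoid (<⇒≢ t<i)) ◅◅ rimⱼ→hub i i-even
    ... | no k≰i  = O₁-rim-walk (≤fromℕ k) (λ t k≤t _ → avoid (<⇒≢ (ℕ.<-≤-trans (ℕ.≰⇒> k≰i) k≤t) ∘ sym))
                    ◅◅ O₁-last→hub (λ ())

  orientations : Fin 2 → Orientation W
  orientations zero       = O₁
  orientations (suc zero) = O₂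

  frankFamily : FrankFamily W 2
  frankFamily = orientations , cover
    where
    cover : ∀ e → ∃ λ i → Deletable W (orientations i) e
    cover (rimEdge t) with last-or-inject₁ t
    ... | inj₁ refl = zero , O₁-deletable-off-cycle (λ ()) (λ ()) (λ t t<last → <⇒≢ t<last ∘ inj₂-injective)
    ... | inj₂ (i , refl) with isEven (toℕ i) in parity
    ...   | true  = zero , O₁-rim-deletable i parity
    ...   | false = suc zero , O₂-rim-deletable (inject₁ i) (trans (isEven-inject₁ i) parity)
    cover (spoke k) with isEven (toℕ k) in parity
    ... | true = suc zero , O₂-spoke-deletable k (parity-separates parity refl)
    ... | false with k ≟ last
    ...   | yes refl  = suc zero , O₂-spoke-deletable last (λ ())
    ...   | no k≢last = zero , O₁-deletable-off-cycle (parity-separates refl parity ∘ inj₁-injective)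
                                                     (k≢last ∘ sym ∘ inj₁-injective) (λ _ _ ())

lemma2p5 : (n : ℕ) → 3 ≤ n → FrankNumber (Wheel n) 2
lemma2p5 (ℕ.suc (ℕ.suc (ℕ.suc m))) _ = FrankPair.frankFamily m , wheel-¬frankFamily<2 (ℕ.suc (ℕ.suc m))
lemma2p5 1 (s≤s ())
lemma2p5 2 (s≤s (s≤s ()))
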